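{- Let $\theta$ be a root of $z^4 - 2z^3 - 4z^2 + 5z - 2$ and $K = \mathbb{Q}(\theta)$. Put $p_2 = \theta$, $q_2 = \theta - 1$, $r_2 = \theta^2 - \theta - 5$, $p_3 = 2\theta^2 - 2\theta + 1$, $\eta_1 = \theta^3 + \theta^2 - 2\theta + 1$, $\eta_2 = \theta^3 - 3\theta + 1$ (a unit of $K$), and $\beta = 2\theta^3 + 2\theta^2 - 6\theta - 3$. Define $Q, X, A, B \in K[t]$ by $$Q(t) = 3p_2^7 q_2 \beta \eta_1^2 \eta_2^{ -1} t^2 + 2q_2^3 \eta_1^2 \beta(\theta^3 - \theta^2 + 11)\,t + q_2^2 \beta^2 \eta_2^2,$$ \begin{align*} X(t) &= 2^4 3^4 p_2^5 q_2^7 \beta \eta_1^8 \eta_2^{ -4} t^6 + 2^3 3^4 q_2^5 r_2 \beta \eta_1^9 \eta_2^{ -4}(17\theta^3 + 2\theta^2 - 71\theta + 33)\,t^5\\ &\quad + 2^2 3^3 q_2 \beta \eta_1^8 \eta_2^{ -3}(1463\theta^3 - 2436\theta^2 - 2667\theta + 1903)\,t^4\\ &\quad + 24 q_2 \beta \eta_1^6 \eta_2^{ -2}(25901\theta^3 + 32060\theta^2 - 52457\theta + 15455)\,t^3\\ &\quad + 12 q_2^2 p_3 \beta \eta_1^3(40374\theta^3 + 47422\theta^2 - 61976\theta + 37707)\,t^2\\ &\quad + 2 q_2^2 r_2^2 p_3 \beta \eta_1^3 \eta_2(7081\theta^3 - 854\theta^2 + 90791\theta - 23035)\,t\\ &\quad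 + q_2 \beta \eta_1 \eta_2^2(190035\theta^3 + 199008\theta^2 - 174189\theta + 50449), \end{align*} \begin{align*} A(t) &= -12 q_2^4 r_2 p_3 \beta^2 \eta_1 \eta_2^{ -3}(\theta^3 - \theta + 1)\,t - q_2^2 p_3 \beta^2 \eta_1^{ -1} \eta_2^{ -2}(\theta^3 - \theta + 1)(9\theta^3 - 2\theta^2 + 5\theta + 9), \end{align*} \begin{align*} B(t) &= -6 q_2^7 r_2^2 \beta^3 \eta_1 \eta_2^{ -4}(2\theta - 1)^4\,t - q_2^4 r_2 \beta^3 \eta_1^{ -1} \eta_2^{ -3}(2\theta - 1)^4(4\theta^3 + 18\theta^2 - 16\theta + 1). \end{align*} Then there exists a polynomial $Y \in K[t]$ of degree $8$ such that $$X(t)^3 + A(t)X(t) + B(t) = Q(t)\,Y(t)^2,$$ and this solution is nondegenerate, i.e.\ $4A(t)^3 + 27B(t)^2$ is not the zero polynomial. -}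

module Defs where

open import Data.Nat using (ℕ; zero; suc; _<_)
open import Data.Integer using (ℤ; +_; -[1+_])
open import Data.Rational using (ℚ; 0ℚ; 1ℚ; _/_) renaming (_+_ to _+ℚ_; _*_ to _*ℚ_; -_ to -ℚ_)
open import Data.List using (List; []; _∷_)
open import Data.Product using (_×_)
open import Relation.Binary.PropositionalEquality using (_≡_)
open import Relation.Nullary using (¬_)

-- The number field K = ℚ(θ) = ℚ[z]/(f),  f = z^4 - 2z^3 - 4z^2 + 5z - 2
-- (f is irreducible over ℚ).  An element ⟨ a , b , c , d ⟩ stands for
-- a + bθ + cθ² + dθ³ (power basis, so ≡ is equality in K).

record K : Set where
  constructor ⟨_,_,_,_⟩
  field
    c0 c1 c2 c3 : ℚ

infixl 6 _+K_
infixl 7 _*K_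

_+K_ : K → K → K
⟨ a0 , a1 , a2 , a3 ⟩ +K ⟨ b0 , b1 , b2 , b3 ⟩ =
  ⟨ a0 +ℚ b0 , a1 +ℚ b1 , a2 +ℚ b2 , a3 +ℚ b3 ⟩

-K_ : K → K
-K ⟨ a0 , a1 , a2 , a3 ⟩ = ⟨ -ℚ a0 , -ℚ a1 , -ℚ a2 , -ℚ a3 ⟩

ι : ℤ → ℚ
ι z = z / 1

-- multiplication: multiply as polynomials, reduce with θ⁴ = 2θ³ + 4θ² - 5θ + 2
_*K_ : K → K → K
⟨ a0 , a1 , a2 , a3 ⟩ *K ⟨ b0 , b1 , b2 , b3 ⟩ =
  let d0 = a0 *ℚ b0
      d1 = a0 *ℚ b1 +ℚ a1 *ℚ b0
      d2 = a0 *ℚ b2 +ℚ a1 *ℚ b1 +ℚ a2 *ℚ b0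
      d3 = a0 *ℚ b3 +ℚ a1 *ℚ b2 +ℚ a2 *ℚ b1 +ℚ a3 *ℚ b0
      d4 = a1 *ℚ b3 +ℚ a2 *ℚ b2 +ℚ a3 *ℚ b1
      d5 = a2 *ℚ b3 +ℚ a3 *ℚ b2
      d6 = a3 *ℚ b3
      two = ι (+ 2) ; four = ι (+ 4) ; m5 = ι -[1+ 4 ]
      -- θ⁶ = θ²·θ⁴
      e5 = d5 +ℚ two *ℚ d6
      e4 = d4 +ℚ four *ℚ d6
      e3 = d3 +ℚ m5 *ℚ d6
      e2 = d2 +ℚ two *ℚ d6
      -- θ⁵ = θ·θ⁴
      f4 = e4 +ℚ two *ℚ e5
      f3 = e3 +ℚ four *ℚ e5
      f2 = e2 +ℚ m5 *ℚ e5
      f1 = d1 +ℚ two *ℚ e5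
      -- θ⁴
      g3 = f3 +ℚ two *ℚ f4
      g2 = f2 +ℚ four *ℚ f4
      g1 = f1 +ℚ m5 *ℚ f4
      g0 = d0 +ℚ two *ℚ f4
  in ⟨ g0 , g1 , g2 , g3 ⟩

0K 1K θ : K
0K = ⟨ 0ℚ , 0ℚ , 0ℚ , 0ℚ ⟩
1K = ⟨ 1ℚ , 0ℚ , 0ℚ , 0ℚ ⟩
θ  = ⟨ 0ℚ , 1ℚ , 0ℚ , 0ℚ ⟩

κ : ℤ → K
κ z = ⟨ ι z , 0ℚ , 0ℚ , 0ℚ ⟩

ν : ℕ → K
ν n = κ (+ n)

μ : ℕ → K
μ n = -K ν n

infixr 8 _^K_
_^K_ : K → ℕ → K
x ^K zero  = 1K
x ^K suc n = x *K (x ^K n)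

-- element a3 θ³ + a2 θ² + a1 θ + a0 with integer coefficients
cub : ℤ → ℤ → ℤ → ℤ → K
cub a3 a2 a1 a0 = ⟨ ι a0 , ι a1 , ι a2 , ι a3 ⟩

p₂ q₂ r₂ p₃ η₁ η₂ β : K
p₂ = θ
q₂ = θ +K μ 1
r₂ = θ ^K 2 +K -K θ +K μ 5
p₃ = ν 2 *K θ ^K 2 +K μ 2 *K θ +K ν 1
η₁ = θ ^K 3 +K θ ^K 2 +K μ 2 *K θ +K ν 1
η₂ = θ ^K 3 +K μ 3 *K θ +K ν 1
β  = ν 2 *K θ ^K 3 +K ν 2 *K θ ^K 2 +K μ 6 *K θ +K μ 3

-- Polynomials in K[t]: coefficient lists, constant term first.
-- Two lists denote the same polynomial iff all coefficients agree
-- (missing coefficients are 0).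

Poly : Set
Poly = List K

coeff : Poly → ℕ → K
coeff []       _       = 0K
coeff (a ∷ p)  zero    = a
coeff (a ∷ p)  (suc n) = coeff p n

infix 4 _≈P_
_≈P_ : Poly → Poly → Set
p ≈P q = ∀ n → coeff p n ≡ coeff q n

infixl 6 _+P_
infixl 7 _*P_ _·P_

_+P_ : Poly → Poly → Poly
[]      +P q       = q
(a ∷ p) +P []      = a ∷ p
(a ∷ p) +P (b ∷ q) = (a +K b) ∷ (p +P q)

_·P_ : K → Poly → Poly
c ·P []      = []
c ·P (a ∷ p) = (c *K a) ∷ (c ·P p)

_*P_ : Poly → Poly → Poly
[]      *P q = []
(a ∷ p) *P q = (a ·P q) +P (0K ∷ (p *P q))

0P : Poly
0P = []

HasDegree : Poly → ℕ → Set
HasDegree p d = ¬ (coeff p d ≡ 0K) × (∀ n → d < n → coeff p n ≡ 0K)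

-- Q, X, A, B.  They involve η₁⁻¹ and η₂⁻¹; these are passed as
-- parameters (the theorem assumes they are inverses of η₁, η₂).

module Curve (η₁⁻¹ η₂⁻¹ : K) where

  QP : Poly
  QP = (q₂ ^K 2 *K β ^K 2 *K η₂ ^K 2)
     ∷ (ν 2 *K q₂ ^K 3 *K η₁ ^K 2 *K β *K cub (+ 1) -[1+ 0 ] (+ 0) (+ 11))
     ∷ (ν 3 *K p₂ ^K 7 *K q₂ *K β *K η₁ ^K 2 *K η₂⁻¹)
     ∷ []

  XP : Poly
  XP = (q₂ *K β *K η₁ *K η₂ ^K 2 *K cub (+ 190035) (+ 199008) -[1+ 174188 ] (+ 50449))
     ∷ (ν 2 *K q₂ ^K 2 *K r₂ ^K 2 *K p₃ *K β *K η₁ ^K 3 *K η₂ *K cub (+ 7081) -[1+ 853 ] (+ 90791) -[1+ 23034 ])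
     ∷ (ν 12 *K q₂ ^K 2 *K p₃ *K β *K η₁ ^K 3 *K cub (+ 40374) (+ 47422) -[1+ 61975 ] (+ 37707))
     ∷ (ν 24 *K q₂ *K β *K η₁ ^K 6 *K η₂⁻¹ ^K 2 *K cub (+ 25901) (+ 32060) -[1+ 52456 ] (+ 15455))
     ∷ (ν 2 ^K 2 *K ν 3 ^K 3 *K q₂ *K β *K η₁ ^K 8 *K η₂⁻¹ ^K 3 *K cub (+ 1463) -[1+ 2435 ] -[1+ 2666 ] (+ 1903))
     ∷ (ν 2 ^K 3 *K ν 3 ^K 4 *K q₂ ^K 5 *K r₂ *K β *K η₁ ^K 9 *K η₂⁻¹ ^K 4 *K cub (+ 17) (+ 2) -[1+ 70 ] (+ 33))
     ∷ (ν 2 ^K 4 *K ν 3 ^K 4 *K p₂ ^K 5 *K q₂ ^K 7 *K β *K η₁ ^K 8 *K η₂⁻¹ ^K 4)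
     ∷ []

  AP : Poly
  AP = (-K (q₂ ^K 2 *K p₃ *K β ^K 2 *K η₁⁻¹ *K η₂⁻¹ ^K 2 *K cub (+ 1) (+ 0) -[1+ 0 ] (+ 1) *K cub (+ 9) -[1+ 1 ] (+ 5) (+ 9)))
     ∷ (-K (ν 12 *K q₂ ^K 4 *K r₂ *K p₃ *K β ^K 2 *K η₁ *K η₂⁻¹ ^K 3 *K cub (+ 1) (+ 0) -[1+ 0 ] (+ 1)))
     ∷ []

  BP : Poly
  BP = (-K (q₂ ^K 4 *K r₂ *K β ^K 3 *K η₁⁻¹ *K η₂⁻¹ ^K 3 *K (ν 2 *K θ +K μ 1) ^K 4 *K cub (+ 4) (+ 18) -[1+ 15 ] (+ 1)))
     ∷ (-K (ν 6 *K q₂ ^K 7 *K r₂ ^K 2 *K β ^K 3 *K η₁ *K η₂⁻¹ ^K 4 *K (ν 2 *K θ +K μ 1) ^K 4))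
     ∷ []

  lhs : Poly
  lhs = XP *P XP *P XP +P AP *P XP +P BP

  rhs : Poly → Poly
  rhs Y = QP *P (Y *P Y)

  disc : Poly
  disc = (ν 4 ·P (AP *P AP *P AP)) +P (ν 27 ·P (BP *P BP))

{-# OPTIONS --safe #-}
-- Multiplication in K is associative (checked coordinatewise with the ring
-- solver over ℚ), so the hypotheses force η₁⁻¹ = −3θ³ + 4θ² + 15θ − 5 and
-- η₂⁻¹ = −θ³ + 3θ² − 1.  Once they are fixed, X³ + AX + B = QY² for an
-- explicit Y of degree 8, and the nonvanishing of the constant term of
-- 4A³ + 27B², are finite computations in K[t], checked by evaluation.
module Submission where

open import Defs
open import Data.Fin using (Fin; #_)
open import Data.Integer using (+_; -[1+_])
open import Data.List using (length; []; _∷_)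
open import Data.Nat using (ℕ; _≤_; s≤s)
open import Data.Product using (Σ; _×_; _,_)
open import Data.Rational using (ℚ)
open import Data.Rational.Solver using (module +-*-Solver)
open import Data.Vec using (Vec; []; _∷_)
open import Function.Nary.NonDependent using (congₙ)
open import Relation.Binary.PropositionalEquality
  using (_≡_; refl; sym; trans; cong; subst₂; module ≡-Reasoning)
open import Relation.Nullary using (¬_)

open +-*-Solver using (Polynomial; con; var; _:+_; _:*_; ⟦_⟧; ⟦_⟧↓; prove)

private
  variable
    n : ℕ

record KExpr (n : ℕ) : Set where
  constructor ⟪_,_,_,_⟫
  field
    c₀ c₁ c₂ c₃ : Polynomial n

open KExpr

⟦_⟧K : KExpr n → Vec ℚ n → K
⟦ x ⟧K ρ = ⟨ ⟦ c₀ x ⟧ ρ , ⟦ c₁ x ⟧ ρ , ⟦ c₂ x ⟧ ρ , ⟦ c₃ x ⟧ ρ ⟩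

constE : K → KExpr n
constE ⟨ a , b , c , d ⟩ = ⟪ con a , con b , con c , con d ⟫

varE : Fin n → Fin n → Fin n → Fin n → KExpr n
varE i j k l = ⟪ var i , var j , var k , var l ⟫

-- A copy of _*K_ in which every step is a ring operation, so that
-- ⟦ x *E y ⟧K ρ reduces to ⟦ x ⟧K ρ *K ⟦ y ⟧K ρ.
infixl 7 _*E_
_*E_ : KExpr n → KExpr n → KExpr n
⟪ a0 , a1 , a2 , a3 ⟫ *E ⟪ b0 , b1 , b2 , b3 ⟫ =
  let d0 = a0 :* b0
      d1 = a0 :* b1 :+ a1 :* b0
      d2 = a0 :* b2 :+ a1 :* b1 :+ a2 :* b0
      d3 = a0 :* b3 :+ a1 :* b2 :+ a2 :* b1 :+ a3 :* b0
      d4 = a1 :* b3 :+ a2 :* b2 :+ a3 :* b1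
      d5 = a2 :* b3 :+ a3 :* b2
      d6 = a3 :* b3
      two = con (ι (+ 2)) ; four = con (ι (+ 4)) ; m5 = con (ι -[1+ 4 ])
      e5 = d5 :+ two :* d6
      e4 = d4 :+ four :* d6
      e3 = d3 :+ m5 :* d6
      e2 = d2 :+ two :* d6
      f4 = e4 :+ two :* e5
      f3 = e3 :+ four :* e5
      f2 = e2 :+ m5 :* e5
      f1 = d1 :+ two :* e5
      g3 = f3 :+ two :* f4
      g2 = f2 :+ four :* f4
      g1 = f1 :+ m5 :* f4
      g0 = d0 :+ two :* f4
  in ⟪ g0 , g1 , g2 , g3 ⟫

proveK : (ρ : Vec ℚ n) (x y : KExpr n) →
         ⟦ c₀ x ⟧↓ ρ ≡ ⟦ c₀ y ⟧↓ ρ → ⟦ c₁ x ⟧↓ ρ ≡ ⟦ c₁ y ⟧↓ ρ →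
         ⟦ c₂ x ⟧↓ ρ ≡ ⟦ c₂ y ⟧↓ ρ → ⟦ c₃ x ⟧↓ ρ ≡ ⟦ c₃ y ⟧↓ ρ →
         ⟦ x ⟧K ρ ≡ ⟦ y ⟧K ρ
proveK ρ x y eq0 eq1 eq2 eq3 =
  congₙ 4 ⟨_,_,_,_⟩ (prove ρ (c₀ x) (c₀ y) eq0) (prove ρ (c₁ x) (c₁ y) eq1)
                    (prove ρ (c₂ x) (c₂ y) eq2) (prove ρ (c₃ x) (c₃ y) eq3)

*K-assoc : ∀ x y z → (x *K y) *K z ≡ x *K (y *K z)
*K-assoc ⟨ x0 , x1 , x2 , x3 ⟩ ⟨ y0 , y1 , y2 , y3 ⟩ ⟨ z0 , z1 , z2 , z3 ⟩ =
  proveK (x0 ∷ x1 ∷ x2 ∷ x3 ∷ y0 ∷ y1 ∷ y2 ∷ y3 ∷ z0 ∷ z1 ∷ z2 ∷ z3 ∷ [])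
         ((x̂ *E ŷ) *E ẑ) (x̂ *E (ŷ *E ẑ)) refl refl refl refl
  where
  x̂ ŷ ẑ : KExpr 12
  x̂ = varE (# 0) (# 1) (# 2) (# 3)
  ŷ = varE (# 4) (# 5) (# 6) (# 7)
  ẑ = varE (# 8) (# 9) (# 10) (# 11)

x̂₄ : KExpr 4
x̂₄ = varE (# 0) (# 1) (# 2) (# 3)

*K-identityˡ : ∀ x → 1K *K x ≡ x
*K-identityˡ ⟨ x0 , x1 , x2 , x3 ⟩ =
  proveK (x0 ∷ x1 ∷ x2 ∷ x3 ∷ []) (constE 1K *E x̂₄) x̂₄ refl refl refl refl

*K-identityʳ : ∀ x → x *K 1K ≡ x
*K-identityʳ ⟨ x0 , x1 , x2 , x3 ⟩ =
  proveK (x0 ∷ x1 ∷ x2 ∷ x3 ∷ []) (x̂₄ *E constE 1K) x̂₄ refl refl refl refl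

*K-inverse-unique : ∀ x y y′ → y *K x ≡ 1K → x *K y′ ≡ 1K → y′ ≡ y
*K-inverse-unique x y y′ yx≡1 xy′≡1 = begin
  y′             ≡⟨ *K-identityˡ y′ ⟨
  1K *K y′       ≡⟨ cong (_*K y′) yx≡1 ⟨
  (y *K x) *K y′ ≡⟨ *K-assoc y x y′ ⟩
  y *K (x *K y′) ≡⟨ cong (y *K_) xy′≡1 ⟩
  y *K 1K        ≡⟨ *K-identityʳ y ⟩
  y              ∎
  where open ≡-Reasoning

coeff-≥length : ∀ p {n} → length p ≤ n → coeff p n ≡ 0K
coeff-≥length []      _           = refl
coeff-≥length (a ∷ p) (s≤s len≤n) = coeff-≥length p len≤n

≡⇒≈P : ∀ {p q} → p ≡ q → p ≈P q
≡⇒≈P p≡q n = cong (λ r → coeff r n) p≡q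

η₁-inv η₂-inv : K
η₁-inv = cub -[1+ 2 ] (+ 4) (+ 15) -[1+ 4 ]
η₂-inv = cub -[1+ 0 ] (+ 3) (+ 0) -[1+ 0 ]

η₁-inverseˡ : η₁-inv *K η₁ ≡ 1K
η₁-inverseˡ = refl

η₂-inverseˡ : η₂-inv *K η₂ ≡ 1K
η₂-inverseˡ = refl

module C = Curve η₁-inv η₂-inv

-- Q, X, A, B are written out so that each is evaluated only once when
-- the curve equation is checked.
Q₀ X₀ A₀ B₀ : Poly
Q₀ = cub (+ 62953) (+ 54853) -[1+ 94336 ] (+ 43847)
   ∷ cub (+ 408994) (+ 356242) -[1+ 612973 ] (+ 284882)
   ∷ cub (+ 661806) (+ 588297) -[1+ 1003724 ] (+ 465390)
   ∷ []

X₀ = cub (+ 119284352552) (+ 103912805991) -[1+ 178789765959 ] (+ 83092083531)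
   ∷ cub (+ 2338506319402) (+ 2037154039392) -[1+ 3505078140247 ] (+ 1628976629930)
   ∷ cub (+ 19102752112176) (+ 16641191598276) -[1+ 28632345876551 ] (+ 13306802663796)
   ∷ cub (+ 83229458944080) (+ 72495420409368) -[1+ 124740106242767 ] (+ 57973464151608)
   ∷ cub (+ 203898731440320) (+ 177981882346692) -[1+ 305972924233535 ] (+ 142167020231412)
   ∷ cub (+ 268331208416424) (+ 225649711953648) -[1+ 394086223026431 ] (+ 183899870705016)
   ∷ cub (+ 128537737727760) (+ 191077876460016) -[1+ 271763415096479 ] (+ 118986923787264)
   ∷ []

A₀ = cub (+ 595536) -[1+ 2314849 ] (+ 1941347) -[1+ 640206 ]
   ∷ cub -[1+ 15263075 ] (+ 59054976) -[1+ 49474055 ] (+ 16302900)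
   ∷ []

B₀ = cub (+ 748612557) -[1+ 2898037801 ] (+ 2428116614) -[1+ 800188586 ]
   ∷ cub -[1+ 26857366733 ] (+ 103968293880) -[1+ 87109423103 ] (+ 28706957994)
   ∷ []

Q-eval : C.QP ≡ Q₀
Q-eval = refl

X-eval : C.XP ≡ X₀
X-eval = refl

A-eval : C.AP ≡ A₀
A-eval = refl

B-eval : C.BP ≡ B₀
B-eval = refl

Y : Poly
Y = cub (+ 164190248000781) (+ 143031876245376) -[1+ 246097161650123 ] (+ 114373060444113)
  ∷ cub (+ 4294997434307910) (+ 3741522631721556) -[1+ 6437572737004595 ] (+ 2991846324306150)
  ∷ cub (+ 49154936742610164) (+ 42820600544630604) -[1+ 73676072391491267 ] (+ 34240774729648500)
  ∷ cub (+ 321472960896593208) (+ 280045121616943524) -[1+ 481839703235747699 ] (+ 223933947728380872)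
  ∷ cub (+ 1314034620496777020) (+ 1144773741250098360) -[1+ 1969617814407038183 ] (+ 915368430576044076)
  ∷ cub (+ 3438299840261479416) (+ 2992470030840630600) -[1+ 5150755056773925863 ] (+ 2394055517252402232)
  ∷ cub (+ 5606823731723924616) (+ 4951916525289450672) -[1+ 8471424498831079631 ] (+ 3930821794934751816)
  ∷ cub (+ 5459528021592677040) (+ 3772843937335749600) -[1+ 7199891642625640991 ] (+ 3437039649781616688)
  ∷ cub (+ 779885476344366336) (+ 7163124697011070656) -[1+ 7652673376223670719 ] (+ 2957034338076004992)
  ∷ []

Y-degree : HasDegree Y 8
Y-degree = (λ ()) , λ _ 8<n → coeff-≥length Y 8<n

cubic : Poly → Poly → Poly → Poly
cubic X A B = X *P X *P X +P A *P X +P B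

curve-identity : cubic X₀ A₀ B₀ ≡ Q₀ *P (Y *P Y)
curve-identity = refl

-- The implicit arguments of cong are supplied because inferring them by
-- unification would evaluate C.QP *P (Y *P Y).
curve-equation : C.lhs ≡ C.rhs Y
curve-equation = begin
  cubic C.XP C.AP C.BP ≡⟨ congₙ 3 cubic X-eval A-eval B-eval ⟩
  cubic X₀ A₀ B₀       ≡⟨ curve-identity ⟩
  Q₀ *P (Y *P Y)       ≡⟨ cong (_*P (Y *P Y)) {C.QP} {Q₀} Q-eval ⟨
  C.QP *P (Y *P Y)     ∎
  where open ≡-Reasoning

D₀ : K
D₀ = cub (+ 221181053091014798883) -[1+ 856221828270051396503 ] (+ 717382350305655832884) -[1+ 236413820113384428104 ]

discriminant-constant : coeff C.disc 0 ≡ D₀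
discriminant-constant = refl

D₀≢0K : ¬ D₀ ≡ 0K
D₀≢0K ()

discriminant-nonzero : ¬ (C.disc ≈P 0P)
discriminant-nonzero disc≈0 = D₀≢0K (trans (sym discriminant-constant) (disc≈0 0))

Conclusion : K → K → Set
Conclusion η₁⁻¹ η₂⁻¹ =
  Σ Poly (λ Y → HasDegree Y 8 × Curve.lhs η₁⁻¹ η₂⁻¹ ≈P Curve.rhs η₁⁻¹ η₂⁻¹ Y)
  × ¬ (Curve.disc η₁⁻¹ η₂⁻¹ ≈P 0P)

conclusion : Conclusion η₁-inv η₂-inv
conclusion = (Y , Y-degree , ≡⇒≈P curve-equation) , discriminant-nonzero

mainTheorem2 : (η₁⁻¹ η₂⁻¹ : K) → η₁ *K η₁⁻¹ ≡ 1K → η₂ *K η₂⁻¹ ≡ 1K →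
                 Σ Poly (λ Y → HasDegree Y 8 × Curve.lhs η₁⁻¹ η₂⁻¹ ≈P Curve.rhs η₁⁻¹ η₂⁻¹ Y)
                 × ¬ (Curve.disc η₁⁻¹ η₂⁻¹ ≈P 0P)
mainTheorem2 η₁⁻¹ η₂⁻¹ η₁η₁⁻¹≡1 η₂η₂⁻¹≡1 =
  subst₂ Conclusion
    (sym (*K-inverse-unique η₁ η₁-inv η₁⁻¹ η₁-inverseˡ η₁η₁⁻¹≡1))
    (sym (*K-inverse-unique η₂ η₂-inv η₂⁻¹ η₂-inverseˡ η₂η₂⁻¹≡1))
    conclusion
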